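{- Let $\mathcal{A}=\{\mathsf{RT}(4),\mathsf{LO}(4)\}$ and $\mathcal{B}=\{\mathsf{RT}(3),\mathsf{LO}(3)\}$. Spoiler wins the $3$-round MS game on $(\mathcal{A},\mathcal{B})$, but Spoiler has no winning strategy in this game in which he never plays on top.
   Context: The schema consists of a single binary relation symbol $<$ (no constants). $\mathsf{RT}(4)$ is the rooted tree with nodes $B1,B11,B12,B13,B21,B22$, root $B1$, and edges $B1$–$B11$, $B11$–$B12$, $B12$–$B13$, $B1$–$B21$, $B21$–$B22$; $\mathsf{RT}(3)$ is the rooted tree with nodes $L1,L11,L12,L21,L22$, root $L1$, and edges $L1$–$L11$, $L11$–$L12$, $L1$–$L21$, $L21$–$L22$. In a tree, $x<y$ holds iff $x$ is a proper descendant of $y$. $\mathsf{LO}(n)$ is the linear order on $n$ elements. Pebbled structures, matching pairs, and the $r$-round MS game: a pebbled structure $\langle \mathbf{A}\mid a_1,\dots,a_t\rangle$ is a structure with elements $a_1,\dots,a_t$, $a_i$ carrying pebble color $i$; two pebbled structures form a matching pair if $a_i\mapsto b_i$ is an isomorphism between the induced substructures on its domain and range. The game starts at $(\mathcal{A}_0,\mathcal{B}_0)=(\mathcal{A},\mathcal{B})$; if no left/right matching pair exists, Spoiler wins. In each round $t=1,\dots,r$ Spoiler chooses a side, say left (right symmetric), and places pebble $t$ on an element of each pebbled structure on that side; Duplicator, for each pebbled structure on the other side, may make any number of copies and places pebble $t$ on an element of each copy. If no left structure forms a matching pair with a right structure, Spoiler wins; Duplicator wins if a matching pair remains after round $r$.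 Spoiler "plays on top" if in some round he places his pebble on an element that already carries a pebble (or interprets a constant symbol). -}

module Defs where

open import Data.Nat using (ℕ; zero; suc; _<ᵇ_)
open import Data.Fin using (Fin; zero; suc; toℕ)
open import Data.Bool using (Bool; true; false)
open import Data.Vec using (Vec; []; _∷_; _∷ʳ_; lookup)
open import Data.List using (List; []; _∷_; _++_; map)
open import Data.List.Relation.Unary.All using (All; []; _∷_)
open import Data.List.Relation.Unary.Any using (Any)
open import Data.Product using (Σ; _×_; _,_)
open import Data.Unit using (⊤)
open import Relation.Nullary using (¬_)
open import Relation.Binary.PropositionalEquality using (_≡_; _≢_)
open import Function.Bundles using (_⇔_)

record Structure : Set where
  constructor mkStructure
  field
    size : ℕ
    rel  : Fin size → Fin size → Bool
open Structure public

LO : ℕ → Structure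
LO n = mkStructure n (λ x y → toℕ x <ᵇ toℕ y)

-- RT(4): nodes 0=B1 (root), 1=B11, 2=B12, 3=B13, 4=B21, 5=B22
-- edges B1–B11, B11–B12, B12–B13, B1–B21, B21–B22.
-- parent relation: B11,B21 ↦ B1; B12 ↦ B11; B13 ↦ B12; B22 ↦ B21.
-- x < y iff x is a proper descendant of y (y a proper ancestor of x).
RT4rel : Fin 6 → Fin 6 → Bool
RT4rel (suc zero) zero = true
RT4rel (suc (suc zero)) zero = true
RT4rel (suc (suc zero)) (suc zero) = true
RT4rel (suc (suc (suc zero))) zero = true
RT4rel (suc (suc (suc zero))) (suc zero) = true
RT4rel (suc (suc (suc zero))) (suc (suc zero)) = true
RT4rel (suc (suc (suc (suc zero)))) zero = true
RT4rel (suc (suc (suc (suc (suc zero))))) zero = true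
RT4rel (suc (suc (suc (suc (suc zero))))) (suc (suc (suc (suc zero)))) = true
RT4rel _ _ = false

RT4 : Structure
RT4 = mkStructure 6 RT4rel

-- RT(3): nodes 0=L1 (root), 1=L11, 2=L12, 3=L21, 4=L22
-- edges L1–L11, L11–L12, L1–L21, L21–L22.
RT3rel : Fin 5 → Fin 5 → Bool
RT3rel (suc zero) zero = true
RT3rel (suc (suc zero)) zero = true
RT3rel (suc (suc zero)) (suc zero) = true
RT3rel (suc (suc (suc zero))) zero = true
RT3rel (suc (suc (suc (suc zero)))) zero = true
RT3rel (suc (suc (suc (suc zero)))) (suc (suc (suc zero))) = true
RT3rel _ _ = false

RT3 : Structure
RT3 = mkStructure 5 RT3rel

-- Pebbled structures with t pebbles: pebble of color i (i : Fin t,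
-- i.e. colors 1..t) lies on element (lookup pebbles i).

record Pebbled (t : ℕ) : Set where
  constructor ⟨_∣_⟩
  field
    struct  : Structure
    pebbles : Vec (Fin (size struct)) t
open Pebbled public

-- Matching pair: a_i ↦ b_i is an isomorphism between the induced
-- substructures on {a_i} and {b_i} (well defined and injective, and
-- preserving/reflecting <).
MatchingPair : ∀ {t} → Pebbled t → Pebbled t → Set
MatchingPair ⟨ A ∣ a ⟩ ⟨ B ∣ b ⟩ =
  ∀ i j → ((lookup a i ≡ lookup a j) ⇔ (lookup b i ≡ lookup b j))
        × (rel A (lookup a i) (lookup a j) ≡ rel B (lookup b i) (lookup b j))

HasMatchingPair : ∀ {t} → List (Pebbled t) → List (Pebbled t) → Set
HasMatchingPair L R = Any (λ P → Any (λ Q → MatchingPair P Q) R) L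

-- Legality of Spoiler placing his pebble on x in P.
-- mayTop = true : any element allowed.
-- mayTop = false: x must not already carry a pebble (no constants exist).
Legal : Bool → ∀ {t} (P : Pebbled t) → Fin (size (struct P)) → Set
Legal true  P x = ⊤
Legal false P x = ∀ i → lookup (pebbles P) i ≢ x

data SpoilerChoice (mayTop : Bool) {t : ℕ} : List (Pebbled t) → Set where
  []  : SpoilerChoice mayTop []
  _∷_ : ∀ {P L} → Σ (Fin (size (struct P))) (Legal mayTop P)
        → SpoilerChoice mayTop L → SpoilerChoice mayTop (P ∷ L)

placeSpoiler : ∀ {mayTop t} (L : List (Pebbled t)) → SpoilerChoice mayTop L
             → List (Pebbled (suc t))
placeSpoiler [] [] = []
placeSpoiler (⟨ A ∣ a ⟩ ∷ L) ((x , _) ∷ c) = ⟨ A ∣ a ∷ʳ x ⟩ ∷ placeSpoiler L c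

-- Duplicator's answer: for each pebbled structure on the other side,
-- a list of elements, one for each copy she makes (any number of copies).
DuplicatorChoice : ∀ {t} → List (Pebbled t) → Set
DuplicatorChoice R = All (λ P → List (Fin (size (struct P)))) R

placeDuplicator : ∀ {t} (R : List (Pebbled t)) → DuplicatorChoice R
                → List (Pebbled (suc t))
placeDuplicator [] [] = []
placeDuplicator (⟨ B ∣ b ⟩ ∷ R) (xs ∷ d) =
  map (λ x → ⟨ B ∣ b ∷ʳ x ⟩) xs ++ placeDuplicator R d

-- Spoiler has a winning strategy in the r-round MS game from position
-- (L , R) (with t pebbles already placed).  mayTop = false restricts
-- Spoiler to strategies in which he never plays on top.

data SpoilerWins (mayTop : Bool) : ℕ → ∀ {t} → List (Pebbled t) → List (Pebbled t) → Set where
  noMatch : ∀ {r t} {L R : List (Pebbled t)}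
          → ¬ HasMatchingPair L R → SpoilerWins mayTop r L R
  playLeft : ∀ {r t} {L R : List (Pebbled t)}
           → (c : SpoilerChoice mayTop L)
           → (∀ (d : DuplicatorChoice R) →
                SpoilerWins mayTop r (placeSpoiler L c) (placeDuplicator R d))
           → SpoilerWins mayTop (suc r) L R
  playRight : ∀ {r t} {L R : List (Pebbled t)}
            → (c : SpoilerChoice mayTop R)
            → (∀ (d : DuplicatorChoice L) →
                 SpoilerWins mayTop r (placeDuplicator L d) (placeSpoiler R c))
            → SpoilerWins mayTop (suc r) L R

𝒜 : List (Pebbled 0)
𝒜 = ⟨ RT4 ∣ [] ⟩ ∷ ⟨ LO 4 ∣ [] ⟩ ∷ []

ℬ : List (Pebbled 0)
ℬ = ⟨ RT3 ∣ [] ⟩ ∷ ⟨ LO 3 ∣ [] ⟩ ∷ []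

-- Spoiler wins from a position are inherited by its sub-positions (fewer pebbled
-- structures on either side), so a Spoiler strategy only has to beat the answer in which
-- Duplicator copies every element; three such rounds leave no matching pair.  Without
-- playing on top, exhaustive search over Spoiler's legal moves shows that Duplicator
-- always has an answer making at most two copies that keeps a matching pair to the end.
module Submission where

open import Defs
open import Data.Bool using (true; false)
open import Data.Product using (_×_)
open import Relation.Nullary using (¬_)

open import Data.Product using (Σ; ∃; _,_; proj₁; proj₂)
open import Level using (Level)
open import Data.Nat using (ℕ; zero; suc; _∸_)
open import Data.Fin using (Fin; zero; suc; #_)
open import Data.Fin.Properties using () renaming (_≟_ to _≟ᶠ_)
open import Data.Bool using (Bool; T; _∧_)
open import Data.Bool.Properties using (T-∧) renaming (_≟_ to _≟ᵇ_)
open import Data.Bool.ListAction using (all; any)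
open import Data.Vec using (_∷ʳ_; lookup)
open import Data.Vec.Functional using (foldr)
open import Data.List using (List; []; _∷_; [_]; _++_; map; concatMap; filter; allFin; downFrom)
open import Data.List.Relation.Unary.All as All using ([]; _∷_; universal)
open import Data.List.Relation.Unary.All.Properties using (all⁺; all⁻)
open import Data.List.Relation.Unary.Any as Any using (here; there; satisfied)
open import Data.List.Relation.Unary.Any.Properties using (any⁺; any⁻; concatMap⁺)
open import Data.List.Membership.Propositional using (_∈_)
open import Data.List.Membership.Propositional.Properties
  using (∈-allFin; ∈-map⁺; ∈-map⁻; ∈-++⁺ˡ; ∈-++⁺ʳ; ∈-++⁻; ∈-filter⁺)
open import Data.List.Relation.Binary.Subset.Propositional using (_⊆_)
open import Data.List.Relation.Binary.Subset.Propositional.Properties using (⊆-refl; Any-resp-⊆)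
open import Data.Sum using (inj₁; inj₂)
open import Data.Unit using (tt)
open import Data.Empty using (⊥-elim)
open import Function using (_∘_; _$_)
open import Function.Bundles using (_⇔_; mk⇔; Equivalence)
open import Relation.Nullary using (Dec; yes; no; does)
open import Relation.Nullary.Decidable using (map′; T?; ¬?)
open import Relation.Binary.PropositionalEquality using (_≡_; refl; cong; subst)

private
  variable
    a b : Level
    A : Set a
    B : Set b
    m : Bool
    n r t : ℕ
    L L′ R R′ : List (Pebbled t)

T-does : (a? : Dec A) → T (does a?) ⇔ A
T-does (yes x) = mk⇔ (λ _ → x) _
T-does (no ¬x) = mk⇔ (λ ()) ¬x

does≡does⇔ : (a? : Dec A) (b? : Dec B) → does a? ≡ does b? ⇔ (A ⇔ B)
does≡does⇔ (yes x) (yes y) = mk⇔ (λ _ → mk⇔ (λ _ → y) (λ _ → x)) (λ _ → refl)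
does≡does⇔ (yes x) (no ¬y) = mk⇔ (λ ()) (λ x⇔y → ⊥-elim (¬y (Equivalence.to x⇔y x)))
does≡does⇔ (no ¬x) (yes y) = mk⇔ (λ ()) (λ x⇔y → ⊥-elim (¬x (Equivalence.from x⇔y y)))
does≡does⇔ (no ¬x) (no ¬y) = mk⇔ (λ _ → mk⇔ (⊥-elim ∘ ¬x) (⊥-elim ∘ ¬y)) (λ _ → refl)

T-foldr-∧ : (f : Fin n → Bool) → T (foldr _∧_ true f) ⇔ (∀ i → T (f i))
T-foldr-∧ {zero}  f = mk⇔ (λ _ ()) _
T-foldr-∧ {suc n} f = mk⇔
  (λ s → let s₀ , s₊ = Equivalence.to (T-∧ {f zero}) s in
         λ { zero → s₀ ; (suc i) → Equivalence.to (T-foldr-∧ (f ∘ suc)) s₊ i })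
  (λ h → Equivalence.from T-∧ (h zero , Equivalence.from (T-foldr-∧ (f ∘ suc)) (h ∘ suc)))

agreeᵇ : (P Q : Pebbled t) → Fin t → Fin t → Bool
agreeᵇ ⟨ A ∣ a ⟩ ⟨ B ∣ b ⟩ i j =
    does (does (lookup a i ≟ᶠ lookup a j) ≟ᵇ does (lookup b i ≟ᶠ lookup b j))
  ∧ does (rel A (lookup a i) (lookup a j) ≟ᵇ rel B (lookup b i) (lookup b j))

T-agreeᵇ : (P Q : Pebbled t) (i j : Fin t)
         → T (agreeᵇ P Q i j)
         ⇔ ((lookup (pebbles P) i ≡ lookup (pebbles P) j ⇔ lookup (pebbles Q) i ≡ lookup (pebbles Q) j)
           × rel (struct P) (lookup (pebbles P) i) (lookup (pebbles P) j)
             ≡ rel (struct Q) (lookup (pebbles Q) i) (lookup (pebbles Q) j))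
T-agreeᵇ ⟨ A ∣ a ⟩ ⟨ B ∣ b ⟩ i j = mk⇔
  (λ s → let same , rel≡ = Equivalence.to (T-∧ {does sameDecision?}) s
         in to sameEquality (to (T-does sameDecision?) same) , to (T-does rel?) rel≡)
  (λ (same , rel≡) → Equivalence.from (T-∧ {does sameDecision?})
                       (from (T-does sameDecision?) (from sameEquality same) , from (T-does rel?) rel≡))
  where
  open Equivalence
  a≟ = lookup a i ≟ᶠ lookup a j
  b≟ = lookup b i ≟ᶠ lookup b j
  sameDecision? = does a≟ ≟ᵇ does b≟
  rel? = rel A (lookup a i) (lookup a j) ≟ᵇ rel B (lookup b i) (lookup b j)
  sameEquality = does≡does⇔ a≟ b≟

-- A plain boolean fold rather than a composite Dec: the search below evaluates it
-- many thousands of times.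
matchingPairᵇ : Pebbled t → Pebbled t → Bool
matchingPairᵇ P Q = foldr _∧_ true λ i → foldr _∧_ true (agreeᵇ P Q i)

T-matchingPairᵇ : (P Q : Pebbled t) → T (matchingPairᵇ P Q) ⇔ MatchingPair P Q
T-matchingPairᵇ P Q = mk⇔
  (λ s i j → Equivalence.to (T-agreeᵇ P Q i j)
               (Equivalence.to (T-foldr-∧ (agreeᵇ P Q i)) (Equivalence.to (T-foldr-∧ _) s i) j))
  (λ match → Equivalence.from (T-foldr-∧ _) λ i → Equivalence.from (T-foldr-∧ (agreeᵇ P Q i)) λ j →
               Equivalence.from (T-agreeᵇ P Q i j) (match i j))

hasMatchingPairᵇ : List (Pebbled t) → List (Pebbled t) → Bool
hasMatchingPairᵇ L R = any (λ P → any (matchingPairᵇ P) R) L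

T-hasMatchingPairᵇ : (L R : List (Pebbled t)) → T (hasMatchingPairᵇ L R) ⇔ HasMatchingPair L R
T-hasMatchingPairᵇ L R = mk⇔
  (Any.map (λ {P} → Any.map (λ {Q} → Equivalence.to (T-matchingPairᵇ P Q)) ∘ any⁻ (matchingPairᵇ P) R)
     ∘ any⁻ matchedIn L)
  (any⁺ matchedIn
     ∘ Any.map (λ {P} → any⁺ (matchingPairᵇ P) ∘ Any.map (λ {Q} → Equivalence.from (T-matchingPairᵇ P Q))))
  where matchedIn = λ P → any (matchingPairᵇ P) R

hasMatchingPair-⊆ : L′ ⊆ L → R′ ⊆ R → HasMatchingPair L′ R′ → HasMatchingPair L R
hasMatchingPair-⊆ L′⊆L R′⊆R = Any-resp-⊆ L′⊆L ∘ Any.map (Any-resp-⊆ R′⊆R)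

extend : (P : Pebbled t) → Fin (size (struct P)) → Pebbled (suc t)
extend ⟨ A ∣ a ⟩ x = ⟨ A ∣ a ∷ʳ x ⟩

choiceAt : SpoilerChoice m L → ∀ {P} → P ∈ L → Σ (Fin (size (struct P))) (Legal m P)
choiceAt (x ∷ c) (here refl) = x
choiceAt (x ∷ c) (there P∈L) = choiceAt c P∈L

∈-placeSpoiler : (c : SpoilerChoice m L) {P : Pebbled t} (P∈L : P ∈ L)
               → extend P (proj₁ (choiceAt c P∈L)) ∈ placeSpoiler L c
∈-placeSpoiler (x ∷ c) (here refl) = here refl
∈-placeSpoiler (x ∷ c) (there P∈L) = there (∈-placeSpoiler c P∈L)

restrict : L′ ⊆ L → SpoilerChoice m L → SpoilerChoice m L′
restrict {L′ = []}     L′⊆L c = []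
restrict {L′ = P ∷ L′} L′⊆L c = choiceAt c (L′⊆L (here refl)) ∷ restrict (L′⊆L ∘ there) c

placeSpoiler-restrict : (L′⊆L : L′ ⊆ L) (c : SpoilerChoice m L)
                      → placeSpoiler L′ (restrict L′⊆L c) ⊆ placeSpoiler L c
placeSpoiler-restrict {L′ = P ∷ L′} L′⊆L c (here refl) = ∈-placeSpoiler c (L′⊆L (here refl))
placeSpoiler-restrict {L′ = P ∷ L′} L′⊆L c (there Q∈) = placeSpoiler-restrict (L′⊆L ∘ there) c Q∈

copyAll : (R : List (Pebbled t)) → DuplicatorChoice R
copyAll = universal (λ Q → allFin (size (struct Q)))

∈-placeDuplicator-copyAll : ∀ {Q} → Q ∈ R → (y : Fin (size (struct Q)))
                          → extend Q y ∈ placeDuplicator R (copyAll R)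
∈-placeDuplicator-copyAll {R = Q ∷ R} (here refl) y = ∈-++⁺ˡ (∈-map⁺ (extend Q) (∈-allFin y))
∈-placeDuplicator-copyAll {R = Q ∷ R} (there Q∈R) y =
  ∈-++⁺ʳ (map (extend Q) (allFin _)) (∈-placeDuplicator-copyAll Q∈R y)

placeDuplicator-⊆ : R′ ⊆ R → (d : DuplicatorChoice R′)
                  → placeDuplicator R′ d ⊆ placeDuplicator R (copyAll R)
placeDuplicator-⊆ {R′ = Q ∷ R′} R′⊆R (ys ∷ d) P∈ with ∈-++⁻ (map (extend Q) ys) P∈
... | inj₁ P∈copies with ∈-map⁻ (extend Q) P∈copies
...   | y , _ , refl = ∈-placeDuplicator-copyAll (R′⊆R (here refl)) y
placeDuplicator-⊆ {R′ = Q ∷ R′} R′⊆R (ys ∷ d) P∈ | inj₂ P∈rest =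
  placeDuplicator-⊆ (R′⊆R ∘ there) d P∈rest

spoilerWins-⊆ : L′ ⊆ L → R′ ⊆ R → SpoilerWins m r L R → SpoilerWins m r L′ R′
spoilerWins-⊆ L′⊆L R′⊆R (noMatch ¬match) = noMatch (¬match ∘ hasMatchingPair-⊆ L′⊆L R′⊆R)
spoilerWins-⊆ {R = R} L′⊆L R′⊆R (playLeft c win) = playLeft (restrict L′⊆L c) λ d →
  spoilerWins-⊆ (placeSpoiler-restrict L′⊆L c) (placeDuplicator-⊆ R′⊆R d) (win (copyAll R))
spoilerWins-⊆ {L = L} L′⊆L R′⊆R (playRight c win) = playRight (restrict R′⊆R c) λ d →
  spoilerWins-⊆ (placeDuplicator-⊆ L′⊆L d) (placeSpoiler-restrict R′⊆R c) (win (copyAll L))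

playLeft-copyAll : (c : SpoilerChoice m L)
                 → SpoilerWins m r (placeSpoiler L c) (placeDuplicator R (copyAll R))
                 → SpoilerWins m (suc r) L R
playLeft-copyAll c win = playLeft c λ d → spoilerWins-⊆ ⊆-refl (placeDuplicator-⊆ ⊆-refl d) win

playRight-copyAll : (c : SpoilerChoice m R)
                  → SpoilerWins m r (placeDuplicator L (copyAll L)) (placeSpoiler R c)
                  → SpoilerWins m (suc r) L R
playRight-copyAll c win = playRight c λ d → spoilerWins-⊆ (placeDuplicator-⊆ ⊆-refl d) ⊆-refl win

-- The second and third moves give one element for each
-- copy in the all-copies answer, in the order of placeDuplicator: the second move first
-- answers in the copies of RT(3) with pebble 1 on L1, L11, L12, L21, L22, then in those
-- of LO(3).  It plays on top in the copies with pebble 1 on L1 or on the top of LO(3).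
spoilerWins : SpoilerWins true 3 𝒜 ℬ
spoilerWins =
  playLeft-copyAll ((# 1 , _) ∷ (# 2 , _) ∷ []) $
  playRight-copyAll ((# 0 , _) ∷ (# 2 , _) ∷ (# 0 , _) ∷ (# 4 , _) ∷ (# 0 , _)
                    ∷ (# 1 , _) ∷ (# 0 , _) ∷ (# 2 , _) ∷ []) $
  playLeft-copyAll ((# 2 , _) ∷ (# 0 , _) ∷ (# 3 , _) ∷ (# 2 , _) ∷ (# 0 , _) ∷ (# 0 , _)
                   ∷ (# 1 , _) ∷ (# 0 , _) ∷ (# 3 , _) ∷ (# 0 , _) ∷ []) $
  noMatch (Equivalence.from (T-hasMatchingPairᵇ _ _))

unrestrict : {L : List (Pebbled t)} → SpoilerChoice m L → SpoilerChoice true L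
unrestrict []            = []
unrestrict ((x , _) ∷ c) = (x , tt) ∷ unrestrict c

placeSpoiler-unrestrict : (c : SpoilerChoice m L) → placeSpoiler L c ≡ placeSpoiler L (unrestrict c)
placeSpoiler-unrestrict []            = refl
placeSpoiler-unrestrict ((x , _) ∷ c) = cong (_ ∷_) (placeSpoiler-unrestrict c)

legal? : (m : Bool) (P : Pebbled t) (x : Fin (size (struct P))) → Dec (Legal m P x)
legal? true  P x = yes tt
legal? false ⟨ A ∣ a ⟩ x =
  map′ (λ s i → Equivalence.to (T-does (¬? (lookup a i ≟ᶠ x))) (Equivalence.to unoccupied s i))
       (λ legal → Equivalence.from unoccupied λ i → Equivalence.from (T-does (¬? (lookup a i ≟ᶠ x))) (legal i))
       (T? (foldr _∧_ true λ i → does (¬? (lookup a i ≟ᶠ x))))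
  where unoccupied = T-foldr-∧ (λ i → does (¬? (lookup a i ≟ᶠ x)))

legalChoices : Bool → (L : List (Pebbled t)) → List (SpoilerChoice true L)
legalChoices m []      = [ [] ]
legalChoices m (P ∷ L) = concatMap (λ x → map ((x , tt) ∷_) (legalChoices m L))
                                   (filter (legal? m P) (allFin _))

∈-legalChoices : (c : SpoilerChoice m L) → unrestrict c ∈ legalChoices m L
∈-legalChoices []                                = here refl
∈-legalChoices {m} {L = P ∷ L} ((x , legal) ∷ c) =
  concatMap⁺ _ (Any.map (λ { refl → ∈-map⁺ ((x , tt) ∷_) (∈-legalChoices c) })
                        (∈-filter⁺ (legal? m P) (∈-allFin x) legal))

listsOfLength : ℕ → (n : ℕ) → List (List (Fin n))
listsOfLength zero    n = [ [] ]
listsOfLength (suc k) n = concatMap (λ x → map (x ∷_) (listsOfLength k n)) (allFin n)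

answersWithCopies : ℕ → (R : List (Pebbled t)) → List (DuplicatorChoice R)
answersWithCopies zero    []      = [ [] ]
answersWithCopies (suc k) []      = []
answersWithCopies k       (Q ∷ R) =
  concatMap (λ j → concatMap (λ ys → map (ys ∷_) (answersWithCopies (k ∸ j) R))
                             (listsOfLength j (size (struct Q))))
            (downFrom (suc k))

-- One copy in total in the last round, one or two before it: this is enough for the
-- search below to succeed, and one copy alone in either earlier round is not.
candidateAnswers : ℕ → (R : List (Pebbled t)) → List (DuplicatorChoice R)
candidateAnswers zero    R = answersWithCopies 1 R
candidateAnswers (suc _) R = answersWithCopies 1 R ++ answersWithCopies 2 R

mutual
  survives : Bool → ℕ → List (Pebbled t) → List (Pebbled t) → Bool
  survives m zero    L R = hasMatchingPairᵇ L R
  survives m (suc r) L R =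
    hasMatchingPairᵇ L R ∧ leftMovesAnswered m r L R ∧ rightMovesAnswered m r L R

  leftMovesAnswered : Bool → ℕ → List (Pebbled t) → List (Pebbled t) → Bool
  leftMovesAnswered m r L R =
    all (λ c → any (λ d → survives m r (placeSpoiler L c) (placeDuplicator R d)) (candidateAnswers r R))
        (legalChoices m L)

  rightMovesAnswered : Bool → ℕ → List (Pebbled t) → List (Pebbled t) → Bool
  rightMovesAnswered m r L R =
    all (λ c → any (λ d → survives m r (placeDuplicator L d) (placeSpoiler R c)) (candidateAnswers r L))
        (legalChoices m R)

survives-suc : T (survives m (suc r) L R)
             → T (hasMatchingPairᵇ L R) × T (leftMovesAnswered m r L R) × T (rightMovesAnswered m r L R)
survives-suc {m} {r} {L = L} {R} s
  with hasMatch , answered ← Equivalence.to (T-∧ {hasMatchingPairᵇ L R}) s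
  = hasMatch , Equivalence.to (T-∧ {leftMovesAnswered m r L R}) answered

survives⇒hasMatchingPair : T (survives m r L R) → HasMatchingPair L R
survives⇒hasMatchingPair {r = zero}  {L = L} {R} s = Equivalence.to (T-hasMatchingPairᵇ L R) s
survives⇒hasMatchingPair {m} {suc r} {L = L} {R} s =
  Equivalence.to (T-hasMatchingPairᵇ L R) (proj₁ (survives-suc {m = m} {r = r} {L = L} {R = R} s))

answer : ∀ {X : Set} (p : SpoilerChoice true L → X → Bool) (xs : List X)
       → T (all (λ c → any (p c) xs) (legalChoices m L))
       → (c : SpoilerChoice m L) → ∃ λ x → T (p (unrestrict c) x)
answer p xs s c = satisfied (any⁻ (p (unrestrict c)) xs
  (All.lookup (all⁺ _ (legalChoices _ _) s) (∈-legalChoices c)))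

survives⇒¬spoilerWins : T (survives m r L R) → ¬ SpoilerWins m r L R
survives⇒¬spoilerWins {m} {r} {L = L} {R} s (noMatch ¬match) =
  ¬match (survives⇒hasMatchingPair {m = m} {r = r} {L = L} {R = R} s)
survives⇒¬spoilerWins {m} {suc r} {L = L} {R} s (playLeft c win) =
  let d , s′ = answer (λ c d → survives m r (placeSpoiler L c) (placeDuplicator R d)) (candidateAnswers r R)
                      (proj₁ (proj₂ (survives-suc {m = m} {r = r} {L = L} {R = R} s))) c
  in survives⇒¬spoilerWins s′
       (subst (λ L′ → SpoilerWins m r L′ (placeDuplicator R d)) (placeSpoiler-unrestrict c) (win d))
survives⇒¬spoilerWins {m} {suc r} {L = L} {R} s (playRight c win) =
  let d , s′ = answer (λ c d → survives m r (placeDuplicator L d) (placeSpoiler R c)) (candidateAnswers r L)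
                      (proj₂ (proj₂ (survives-suc {m = m} {r = r} {L = L} {R = R} s))) c
  in survives⇒¬spoilerWins s′
       (subst (SpoilerWins m r (placeDuplicator L d)) (placeSpoiler-unrestrict c) (win d))

duplicatorSurvives : ¬ SpoilerWins false 3 𝒜 ℬ
duplicatorSurvives = survives⇒¬spoilerWins _

proposition4p1 : SpoilerWins true 3 𝒜 ℬ × ¬ SpoilerWins false 3 𝒜 ℬ
proposition4p1 = spoilerWins , duplicatorSurvives
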